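{- Fix a total order $\prec$ on $\mathbb{F}_q$ in which $0$ is the smallest element and $1$ the second smallest, and extend it lexicographically to a total order $\prec$ on $\mathbb{F}_q^n$. Let $U$ be a nonzero subspace of $\mathbb{F}_q^n$ with reduced row echelon form $[u_k,u_{k-1},\dots,u_1]^T$ (so the leading indices satisfy $p(u_k)<\cdots<p(u_1)$). If $u$ is the $\prec$-minimum of $U\setminus\{0\}$, then $u=u_1$, i.e. $u$ is the last row of the reduced row echelon form of $U$.
   Context: For a nonzero $v\in\mathbb{F}_q^n$, $p(v)$ denotes the least index $i$ with $v_i\ne0$. -}

module Defs where

open import Level using (Level; _⊔_) renaming (suc to lsuc)
open import Data.Nat using (ℕ)
open import Data.Fin using (Fin; zero; suc; _<_)
open import Data.Product using (Σ; ∃; _×_; _,_)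
open import Data.Sum using (_⊎_)
open import Data.List using (List)
open import Data.List.Relation.Unary.Any using (Any)
open import Relation.Nullary using (¬_)
open import Relation.Binary.PropositionalEquality using (_≡_)
open import Relation.Binary using (Rel; IsStrictTotalOrder)
open import Algebra.Bundles using (CommutativeRing)

record FiniteField (c ℓ : Level) : Set (lsuc (c ⊔ ℓ)) where
  field
    cring : CommutativeRing c ℓ
  open CommutativeRing cring public
  field
    0≉1      : ¬ (0# ≈ 1#)
    inverse  : ∀ a → ¬ (a ≈ 0#) → Σ Carrier λ b → (a * b) ≈ 1#
    elements : List Carrier
    complete : ∀ a → Any (a ≈_) elements

module _ {c ℓ : Level} (F : FiniteField c ℓ) where
  open FiniteField F hiding (zero)

  Vec : ℕ → Set c
  Vec n = Fin n → Carrier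

  zeroV : ∀ {n} → Vec n
  zeroV _ = 0#

  _≈V_ : ∀ {n} → Vec n → Vec n → Set ℓ
  v ≈V w = ∀ j → v j ≈ w j

  Nonzero : ∀ {n} → Vec n → Set ℓ
  Nonzero v = ¬ (v ≈V zeroV)

  IsLeadingIndex : ∀ {n} → Vec n → Fin n → Set ℓ
  IsLeadingIndex v i = ¬ (v i ≈ 0#) × (∀ j → j < i → v j ≈ 0#)

  sumF : ∀ {k} → (Fin k → Carrier) → Carrier
  sumF {ℕ.zero}  f = 0#
  sumF {ℕ.suc k} f = f zero + sumF (λ i → f (suc i))

  InSpan : ∀ {k n} → (Fin k → Vec n) → Vec n → Set (c ⊔ ℓ)
  InSpan R v = Σ (Fin _ → Carrier) λ coef → ∀ j → v j ≈ sumF (λ i → coef i * R i j)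

  -- R (rows listed top to bottom, R zero = first row) is a matrix in
  -- reduced row echelon form with pivot columns piv:
  -- piv i = p(R i), the pivot entries are 1, pivots strictly increase
  -- going down, and every pivot column is zero outside its pivot row.
  record IsRREF {k n} (R : Fin k → Vec n) (piv : Fin k → Fin n) : Set ℓ where
    field
      leading   : ∀ i → IsLeadingIndex (R i) (piv i)
      pivot-one : ∀ i → R i (piv i) ≈ 1#
      increasing : ∀ i i′ → i < i′ → piv i < piv i′
      column-clear : ∀ i i′ → ¬ (i ≡ i′) → R i′ (piv i) ≈ 0#

  module _ {o} (_≺F_ : Rel Carrier o) where
    _≺_ : ∀ {n} → Vec n → Vec n → Set (ℓ ⊔ o)
    v ≺ w = ∃ λ i → (∀ j → j < i → v j ≈ w j) × (v i ≺F w i)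

    _⪯_ : ∀ {n} → Vec n → Vec n → Set (ℓ ⊔ o)
    v ⪯ w = v ≺ w ⊎ v ≈V w

{-# OPTIONS --safe #-}
module Submission where

-- Every row of a reduced row echelon matrix lies in the span it generates, with
-- the row's own pivot column as coefficients; conversely a vector of the span has
-- its coefficients as its pivot entries. So a nonzero vector u of U that is
-- lexicographically below the last row u₁ must agree with u₁ (hence vanish)
-- before p(u₁), which kills every coefficient except the last: u = u(p(u₁)) · u₁.
-- Since u(p(u₁)) ⪯ 1 = u₁(p(u₁)), that scalar is 0 or 1, giving u = 0 or u = u₁,
-- neither of which is strictly below u₁.

open import Defs
open import Level using (Level)
open import Data.Nat using (ℕ)
open import Data.Fin using (Fin; fromℕ)
open import Data.Product using (_×_)
open import Relation.Nullary using (¬_)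
open import Relation.Binary using (Rel; IsStrictTotalOrder)

open import Data.Fin using (zero; suc; _<_; _≤_)
open import Data.Fin.Properties using (<-cmp; ≤∧≢⇒<; ≤fromℕ; suc-injective)
open import Data.Nat.Properties using (<-≤-trans; <⇒≤; ≤-refl)
open import Data.Product using (_,_; proj₁; proj₂)
open import Data.Sum using (inj₁; inj₂)
open import Data.Empty using (⊥-elim)
open import Relation.Binary.PropositionalEquality as ≡ using (_≢_)
open import Relation.Binary.Definitions using (tri<; tri≈; tri>)
open import Relation.Nullary using (yes; no)

module Sums {c ℓ : Level} (F : FiniteField c ℓ) where
  open FiniteField F hiding (zero)

  sumF-zero : ∀ {k} (f : Fin k → Carrier) → (∀ i → f i ≈ 0#) → sumF F f ≈ 0#
  sumF-zero {ℕ.zero}  f f≈0 = refl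
  sumF-zero {ℕ.suc k} f f≈0 =
    trans (+-cong (f≈0 zero) (sumF-zero (λ i → f (suc i)) (λ i → f≈0 (suc i))))
          (+-identityˡ 0#)

  sumF-single : ∀ {k} (f : Fin k → Carrier) (i₀ : Fin k) →
                (∀ i → i ≢ i₀ → f i ≈ 0#) → sumF F f ≈ f i₀
  sumF-single {ℕ.suc k} f zero f≈0 =
    trans (+-cong refl (sumF-zero (λ i → f (suc i)) (λ i → f≈0 (suc i) (λ ()))))
          (+-identityʳ (f zero))
  sumF-single {ℕ.suc k} f (suc i₀) f≈0 =
    trans (+-cong (f≈0 zero (λ ()))
                  (sumF-single (λ i → f (suc i)) i₀
                               (λ i i≢i₀ → f≈0 (suc i) (λ eq → i≢i₀ (suc-injective eq)))))
          (+-identityˡ _)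

module ReducedRowEchelon {c ℓ : Level} (F : FiniteField c ℓ)
  {k n : ℕ} {R : Fin k → Vec F n} {piv : Fin k → Fin n} (rref : IsRREF F R piv) where
  open FiniteField F hiding (zero)
  open Sums F
  open IsRREF rref

  coefficient≈pivot-entry : ∀ {u : Vec F n} (coef : Fin k → Carrier) →
                            (∀ j → u j ≈ sumF F (λ i → coef i * R i j)) →
                            ∀ i → u (piv i) ≈ coef i
  coefficient≈pivot-entry coef u≈Σ i =
    trans (u≈Σ (piv i))
      (trans (sumF-single _ i (λ i′ i′≢i →
                trans (*-cong refl (column-clear i i′ (λ i≡i′ → i′≢i (≡.sym i≡i′))))
                      (zeroʳ (coef i′))))
             (trans (*-cong refl (pivot-one i)) (*-identityʳ (coef i))))

  row-inSpan : ∀ i → InSpan F R (R i)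
  row-inSpan i = (λ i′ → R i′ (piv i)) , λ j →
    sym (trans (sumF-single _ i (λ i′ i′≢i →
                  trans (*-cong (column-clear i i′ (λ i≡i′ → i′≢i (≡.sym i≡i′))) refl)
                        (zeroˡ _)))
               (trans (*-cong (pivot-one i) refl) (*-identityˡ (R i j))))

  row-nonzero : ∀ i → Nonzero F (R i)
  row-nonzero i Rᵢ≈0 = proj₁ (leading i) (Rᵢ≈0 (piv i))

  -- The coefficient of each earlier row is an entry of u before piv i₀, hence 0.
  inSpan-vanishing⇒multiple-of-row :
    ∀ {u : Vec F n} i₀ → InSpan F R u → (∀ i → i ≢ i₀ → piv i < piv i₀) →
    (∀ j → j < piv i₀ → u j ≈ 0#) → ∀ j → u j ≈ u (piv i₀) * R i₀ j
  inSpan-vanishing⇒multiple-of-row {u} i₀ (coef , u≈Σ) earlier vanish j =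
    trans (u≈Σ j)
      (trans (sumF-single _ i₀ (λ i i≢i₀ →
                trans (*-cong (trans (sym (pivot-entry i)) (vanish _ (earlier i i≢i₀))) refl)
                      (zeroˡ _)))
             (*-cong (sym (pivot-entry i₀)) refl))
    where
    pivot-entry : ∀ i → u (piv i) ≈ coef i
    pivot-entry = coefficient≈pivot-entry coef u≈Σ

module ZeroOneLeast {c ℓ o : Level} (F : FiniteField c ℓ)
  {_≺F_ : Rel (FiniteField.Carrier F) o}
  (sto : IsStrictTotalOrder (FiniteField._≈_ F) _≺F_)
  (0-least : ∀ a → ¬ FiniteField._≈_ F a (FiniteField.0# F) → FiniteField.0# F ≺F a)
  (1-next : ∀ a → ¬ FiniteField._≈_ F a (FiniteField.0# F) →
            ¬ FiniteField._≈_ F a (FiniteField.1# F) → FiniteField.1# F ≺F a) where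
  open FiniteField F hiding (zero)
  open IsStrictTotalOrder sto using (_≟_; irrefl; asym; <-respʳ-≈)

  ≮0 : ∀ a → ¬ (a ≺F 0#)
  ≮0 a a≺0 with a ≟ 0#
  ... | yes a≈0 = irrefl a≈0 a≺0
  ... | no  a≉0 = asym a≺0 (0-least a a≉0)

  ≺1⇒≈0 : ∀ a → a ≺F 1# → a ≈ 0#
  ≺1⇒≈0 a a≺1 with a ≟ 0#
  ... | yes a≈0 = a≈0
  ... | no  a≉0 with a ≟ 1#
  ...   | yes a≈1 = ⊥-elim (irrefl a≈1 a≺1)
  ...   | no  a≉1 = ⊥-elim (asym a≺1 (1-next a a≉0 a≉1))

  module _ {m n : ℕ} {R : Fin (ℕ.suc m) → Vec F n} {piv : Fin (ℕ.suc m) → Fin n}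
    (rref : IsRREF F R piv) where
    open IsRREF rref
    open ReducedRowEchelon F rref

    last : Fin (ℕ.suc m)
    last = fromℕ m

    pivot<last-pivot : ∀ i → i ≢ last → piv i < piv last
    pivot<last-pivot i i≢last = increasing i last (≤∧≢⇒< (≤fromℕ i) i≢last)

    agree-beyond-last-pivot⇒multiple : ∀ {u : Vec F n} {k : Fin n} → InSpan F R u →
      (∀ j → j < k → u j ≈ R last j) → piv last ≤ k →
      ∀ j → u j ≈ u (piv last) * R last j
    agree-beyond-last-pivot⇒multiple u∈R agree p≤k =
      inSpan-vanishing⇒multiple-of-row last u∈R pivot<last-pivot
        (λ j j<p → trans (agree j (<-≤-trans j<p p≤k)) (proj₂ (leading last) j j<p))

    inSpan-nonzero-≮-last-row : ∀ {u : Vec F n} → InSpan F R u → Nonzero F u → ¬ (_≺_ F _≺F_ u (R last))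
    inSpan-nonzero-≮-last-row {u} u∈R u≉0 (k , agree , uₖ≺) with <-cmp k (piv last)
    ... | tri< k<p _ _ = ≮0 (u k) (<-respʳ-≈ (proj₂ (leading last) k k<p) uₖ≺)
    ... | tri≈ _ ≡.refl _ = u≉0 λ j →
      trans (agree-beyond-last-pivot⇒multiple u∈R agree ≤-refl j)
            (trans (*-cong (≺1⇒≈0 _ (<-respʳ-≈ (pivot-one last) uₖ≺)) refl) (zeroˡ _))
    ... | tri> _ _ p<k = irrefl u≈R-last uₖ≺
      where
      u≈R-last : u k ≈ R last k
      u≈R-last = trans (agree-beyond-last-pivot⇒multiple u∈R agree (<⇒≤ p<k) k)
                       (trans (*-cong (trans (agree _ p<k) (pivot-one last)) refl) (*-identityˡ _))

lemma5p3 : ∀ {c ℓ o p : Level} (F : FiniteField c ℓ)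
    → (_≺F_ : Rel (FiniteField.Carrier F) o)
    → IsStrictTotalOrder (FiniteField._≈_ F) _≺F_
    → (∀ a → ¬ FiniteField._≈_ F a (FiniteField.0# F) → FiniteField.0# F ≺F a)
    → (∀ a → ¬ FiniteField._≈_ F a (FiniteField.0# F) → ¬ FiniteField._≈_ F a (FiniteField.1# F) → FiniteField.1# F ≺F a)
    → (n m : ℕ) (U : Vec F n → Set p)
    → (R : Fin (ℕ.suc m) → Vec F n) (piv : Fin (ℕ.suc m) → Fin n)
    → IsRREF F R piv
    → (∀ v → (U v → InSpan F R v) × (InSpan F R v → U v))
    → (u : Vec F n) → U u → Nonzero F u
    → (∀ w → U w → Nonzero F w → _⪯_ F _≺F_ u w)
    → _≈V_ F u (R (fromℕ m))
lemma5p3 F _≺F_ sto 0-least 1-next n m U R piv rref U≡span u u∈U u≉0 minimal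
  with minimal (R (fromℕ m)) (proj₂ (U≡span _) (row-inSpan (fromℕ m))) (row-nonzero (fromℕ m))
  where open ReducedRowEchelon F rref
... | inj₂ u≈last = u≈last
... | inj₁ u≺last =
  ⊥-elim (inSpan-nonzero-≮-last-row rref (proj₁ (U≡span u) u∈U) u≉0 u≺last)
  where open ZeroOneLeast F sto 0-least 1-next
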